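{- Let $\succ'$ be a binary relation on $\mathcal{P}(\mathcal{P}r)$. There exists a smallest multi-evaluation relation $\succ'^{*}$ containing $\succ'$, and $\mathcal{S}_{\succ'^{*}}=\mathcal{S}_{\succ'}$.
   Context: $\lambda_c$-calculus. Fix a countably infinite set of variables. $\lambda_c$-terms: $t,u ::= x \mid tu \mid \lambda x.t \mid \mathrm{cc} \mid k_\pi$ ($\pi$ a stack) $\mid \kappa_m$ ($m\in\mathbb{N}$) $\mid \beta_m$ ($m\in\mathbb{N}$), modulo $\alpha$-equivalence. A term is a closed $\lambda_c$-term. Stacks: $\pi ::= \omega_m \mid t\cdot\pi$ ($t$ a term). Processes: $t\star\pi$; $\mathcal{P}r$ is the set of processes. One-step evaluation $\succ_1$ is the smallest relation on processes with $tu\star\pi \succ_1 t\star u\cdot\pi$, $\lambda x.t\star u\cdot\pi\succ_1 t[x:=u]\star\pi$, $\mathrm{cc}\star t\cdot\pi\succ_1 t\star k_\pi\cdot\pi$, $k_{\pi'}\star t\cdot\pi\succ_1 t\star\pi'$; $\succ$ its reflexive-transitive closure. A pole is a set $\perp\!\!\!\perp\subseteq\mathcal{P}r$ with $p\succ q$, $q\in\perp\!\!\!\perp\Rightarrow p\in\perp\!\!\!\perp$. A multi-evaluation relation is a binary relation $R$ on $\mathcal{P}(\mathcal{P}r)$ such that: $p\succ_1 q$ implies $\{p\}R\{q\}$; $\{p\}R\{p\}$ for every process $p$; (cut) if $P\,R\,(Q\cup\{r\})$ and $(P'\cup\{r\})\,R\,Q'$ then $(P\cup P')\,R\,(Q\cup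 Q')$; (weakening) if $P\,R\,Q$, $P\subseteq P'$, $Q\subseteq Q'$ then $P'\,R\,Q'$. For a binary relation $R$ on $\mathcal{P}(\mathcal{P}r)$, $\mathcal{S}_{R}$ is the set of all poles $\perp\!\!\!\perp$ such that for all $P\,R\,Q$, $Q\subseteq\perp\!\!\!\perp$ implies $P\cap\perp\!\!\!\perp\ne\emptyset$. -}

module Defs where

open import Level using (0ℓ)
open import Data.Nat using (ℕ; zero; suc)
open import Data.Fin using (Fin; zero; suc)
open import Data.Product using (Σ; ∃; _×_; _,_)
open import Data.Sum using (_⊎_; inj₁; inj₂)
open import Relation.Binary.PropositionalEquality using (_≡_)
open import Relation.Unary using (Pred; _∈_; _⊆_; _∪_; _∩_; Satisfiable)

-- λc-terms with de Bruijn indices (so α-equivalence is syntactic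
-- equality).  Tm n = terms with at most n free variables; a "term" of
-- the paper (closed) is Tm 0.  Stacks contain closed terms.

data Stack : Set
data Tm (n : ℕ) : Set

data Tm n where
  var : Fin n → Tm n
  app : Tm n → Tm n → Tm n
  lam : Tm (suc n) → Tm n
  cc  : Tm n
  k   : Stack → Tm n
  κ   : ℕ → Tm n
  β   : ℕ → Tm n

data Stack where
  ω   : ℕ → Stack
  _·_ : Tm 0 → Stack → Stack

Term : Set
Term = Tm 0

ren : ∀ {m n} → (Fin m → Fin n) → Tm m → Tm n
ren ρ (var i)   = var (ρ i)
ren ρ (app t u) = app (ren ρ t) (ren ρ u)
ren ρ (lam t)   = lam (ren (λ { zero → zero ; (suc i) → suc (ρ i) }) t)
ren ρ cc        = cc
ren ρ (k π)     = k π
ren ρ (κ m)     = κ m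
ren ρ (β m)     = β m

embed : ∀ {n} → Term → Tm n
embed = ren (λ ())

Sub : ℕ → ℕ → Set
Sub m n = Fin m → Fin n ⊎ Term

liftSub : ∀ {m n} → Sub m n → Sub (suc m) (suc n)
liftSub σ zero    = inj₁ zero
liftSub σ (suc i) with σ i
... | inj₁ j = inj₁ (suc j)
... | inj₂ u = inj₂ u

sub : ∀ {m n} → Sub m n → Tm m → Tm n
sub σ (var i) with σ i
... | inj₁ j = var j
... | inj₂ u = embed u
sub σ (app t u) = app (sub σ t) (sub σ u)
sub σ (lam t)   = lam (sub (liftSub σ) t)
sub σ cc        = cc
sub σ (k π)     = k π
sub σ (κ m)     = κ m
sub σ (β m)     = β m

_[0:=_] : Tm 1 → Term → Term
t [0:= u ] = sub (λ { zero → inj₂ u }) t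

record Process : Set where
  constructor _⋆_
  field
    tm : Term
    st : Stack

data _≻₁_ : Process → Process → Set where
  push : ∀ {t u π}  → (app t u ⋆ π) ≻₁ (t ⋆ (u · π))
  grab : ∀ {t u π}  → (lam t ⋆ (u · π)) ≻₁ ((t [0:= u ]) ⋆ π)
  save : ∀ {t π}    → (cc ⋆ (t · π)) ≻₁ (t ⋆ (k π · π))
  rest : ∀ {π' t π} → (k π' ⋆ (t · π)) ≻₁ (t ⋆ π')

data _≻_ : Process → Process → Set where
  ≻-refl : ∀ {p} → p ≻ p
  ≻-step : ∀ {p q r} → p ≻₁ q → q ≻ r → p ≻ r

PSet : Set₁
PSet = Pred Process 0ℓ

IsPole : PSet → Set
IsPole ⊥⊥ = ∀ p q → p ≻ q → q ∈ ⊥⊥ → p ∈ ⊥⊥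

PRel : Set₂
PRel = PSet → PSet → Set₁

｛_｝ : Process → PSet
｛ p ｝ = λ q → p ≡ q

_⊆₂_ : PRel → PRel → Set₁
R ⊆₂ R' = ∀ P Q → R P Q → R' P Q

record IsMultiEval (R : PRel) : Set₁ where
  field
    step   : ∀ p q → p ≻₁ q → R ｛ p ｝ ｛ q ｝
    refl   : ∀ p → R ｛ p ｝ ｛ p ｝
    cut    : ∀ P Q r P' Q' → R P (Q ∪ ｛ r ｝) → R (P' ∪ ｛ r ｝) Q' →
             R (P ∪ P') (Q ∪ Q')
    weaken : ∀ P Q P' Q' → R P Q → P ⊆ P' → Q ⊆ Q' → R P' Q'

𝒮 : PRel → PSet → Set₁
𝒮 R ⊥⊥ = IsPole ⊥⊥ × (∀ P Q → R P Q → Q ⊆ ⊥⊥ → Satisfiable (P ∩ ⊥⊥))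

module Submission where

-- The smallest multi-evaluation relation containing a relation R' is its
-- inductive closure `MultiEvalClosure R'` under the four rules (one-step
-- evaluation, reflexivity, cut, weakening), with R' added as a base rule;
-- it is a multi-evaluation relation by construction and contained in every
-- other one by structural recursion on derivations.
--
-- For the poles, 𝒮 is antitone in the relation, so 𝒮 (closure) ⊆ 𝒮 R'.
-- Conversely, a set ⊥⊥ lies in 𝒮 R exactly when it is a pole and R is
-- contained in the relation `Separates ⊥⊥` ("Q ⊆ ⊥⊥ forces P to meet ⊥⊥").
-- The key fact is that `Separates ⊥⊥` is itself a multi-evaluation relation
-- whenever ⊥⊥ is a pole; minimality of the closure then shows that the
-- closure of R' is contained in `Separates ⊥⊥` as soon as R' is, i.e.
-- 𝒮 R' ⊆ 𝒮 (closure).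

open import Defs
open import Data.Product using (Σ; _×_; _,_)
open import Data.Sum using (inj₁; inj₂)
open import Relation.Binary.PropositionalEquality using (refl; subst)
open import Level using (Lift; lift; lower)
open import Relation.Unary using (_∈_; _⊆_; _∪_; _∩_; Satisfiable)

data MultiEvalClosure (R' : PRel) : PRel where
  base   : ∀ {P Q} → R' P Q → MultiEvalClosure R' P Q
  step   : ∀ p q → p ≻₁ q → MultiEvalClosure R' ｛ p ｝ ｛ q ｝
  refl   : ∀ p → MultiEvalClosure R' ｛ p ｝ ｛ p ｝
  cut    : ∀ P Q r P' Q' →
           MultiEvalClosure R' P (Q ∪ ｛ r ｝) →
           MultiEvalClosure R' (P' ∪ ｛ r ｝) Q' →
           MultiEvalClosure R' (P ∪ P') (Q ∪ Q')
  weaken : ∀ P Q P' Q' → MultiEvalClosure R' P Q → P ⊆ P' → Q ⊆ Q' →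
           MultiEvalClosure R' P' Q'

closure-isMultiEval : ∀ R' → IsMultiEval (MultiEvalClosure R')
closure-isMultiEval R' = record
  { step = step ; refl = refl ; cut = cut ; weaken = weaken }

closure-contains : ∀ R' → R' ⊆₂ MultiEvalClosure R'
closure-contains R' P Q = base

closure-least : ∀ R' R → IsMultiEval R → R' ⊆₂ R → MultiEvalClosure R' ⊆₂ R
closure-least R' R isME R'⊆R = interpret
  where
  module R = IsMultiEval isME
  interpret : MultiEvalClosure R' ⊆₂ R
  interpret P Q (base r)      = R'⊆R P Q r
  interpret _ _ (step p q s)  = R.step p q s
  interpret _ _ (refl p)      = R.refl p
  interpret _ _ (cut P Q r P' Q' d e) =
    R.cut P Q r P' Q' (interpret _ _ d) (interpret _ _ e)
  interpret _ _ (weaken P Q P' Q' d P⊆P' Q⊆Q') =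
    R.weaken P Q P' Q' (interpret _ _ d) P⊆P' Q⊆Q'

𝒮-antitone : ∀ {R₁ R₂} → R₁ ⊆₂ R₂ → ∀ ⊥⊥ → 𝒮 R₂ ⊥⊥ → 𝒮 R₁ ⊥⊥
𝒮-antitone R₁⊆R₂ ⊥⊥ (pole , sep) = pole , λ P Q r → sep P Q (R₁⊆R₂ P Q r)

-- The largest relation whose 𝒮 contains ⊥⊥: P is related to Q when
-- Q ⊆ ⊥⊥ forces P to meet ⊥⊥.
Separates : PSet → PRel
Separates ⊥⊥ P Q = Lift _ (Q ⊆ ⊥⊥ → Satisfiable (P ∩ ⊥⊥))

-- Cut preserves separation: if every element of Q' lies in ⊥⊥, then either
-- P' meets ⊥⊥, or r ∈ ⊥⊥, whence Q ∪ {r} ⊆ ⊥⊥ and P meets ⊥⊥.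
separates-cut : ∀ ⊥⊥ P Q r P' Q' →
  Separates ⊥⊥ P (Q ∪ ｛ r ｝) → Separates ⊥⊥ (P' ∪ ｛ r ｝) Q' →
  Separates ⊥⊥ (P ∪ P') (Q ∪ Q')
separates-cut ⊥⊥ P Q r P' Q' (lift sepL) (lift sepR) = lift separated
  where
  extend : Q ∪ Q' ⊆ ⊥⊥ → r ∈ ⊥⊥ → Q ∪ ｛ r ｝ ⊆ ⊥⊥
  extend QQ'⊆⊥⊥ r∈⊥⊥ (inj₁ q)    = QQ'⊆⊥⊥ (inj₁ q)
  extend QQ'⊆⊥⊥ r∈⊥⊥ (inj₂ refl) = r∈⊥⊥

  separated : Q ∪ Q' ⊆ ⊥⊥ → Satisfiable ((P ∪ P') ∩ ⊥⊥)
  separated QQ'⊆⊥⊥ with sepR (λ q' → QQ'⊆⊥⊥ (inj₂ q'))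
  ... | x , inj₁ x∈P' , x∈⊥⊥ = x , inj₂ x∈P' , x∈⊥⊥
  ... | _ , inj₂ refl , r∈⊥⊥ with sepL (extend QQ'⊆⊥⊥ r∈⊥⊥)
  ...   | y , y∈P , y∈⊥⊥ = y , inj₁ y∈P , y∈⊥⊥

-- For a pole ⊥⊥, `Separates ⊥⊥` is a multi-evaluation relation; closure of
-- ⊥⊥ under anti-evaluation is exactly what the evaluation rule needs.
separates-isMultiEval : ∀ ⊥⊥ → IsPole ⊥⊥ → IsMultiEval (Separates ⊥⊥)
separates-isMultiEval ⊥⊥ pole = record
  { step   = λ p q p≻₁q → lift λ q∈⊥⊥ →
               p , refl , pole p q (≻-step p≻₁q ≻-refl) (q∈⊥⊥ refl)
  ; refl   = λ p → lift λ p∈⊥⊥ → p , refl , p∈⊥⊥ refl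
  ; cut    = separates-cut ⊥⊥
  ; weaken = λ P Q P' Q' (lift sep) P⊆P' Q⊆Q' → lift λ Q'⊆⊥⊥ →
               let x , x∈P , x∈⊥⊥ = sep (λ q → Q'⊆⊥⊥ (Q⊆Q' q))
               in  x , P⊆P' x∈P , x∈⊥⊥
  }

-- A pole in 𝒮 R' is also in 𝒮 of the closure: R' ⊆ Separates ⊥⊥, and the
-- latter is a multi-evaluation relation, so it contains the closure.
𝒮-closure : ∀ R' ⊥⊥ → 𝒮 R' ⊥⊥ → 𝒮 (MultiEvalClosure R') ⊥⊥
𝒮-closure R' ⊥⊥ (pole , sep) = pole , λ P Q d →
  lower (closure-least R' (Separates ⊥⊥) (separates-isMultiEval ⊥⊥ pole)
           (λ P Q r → lift (sep P Q r)) P Q d)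

mainTheorem12 : (R' : PRel) →
    Σ PRel (λ R* →
      (IsMultiEval R* × R' ⊆₂ R*
        × (∀ R → IsMultiEval R → R' ⊆₂ R → R* ⊆₂ R))
      × (∀ ⊥⊥ → (𝒮 R* ⊥⊥ → 𝒮 R' ⊥⊥) × (𝒮 R' ⊥⊥ → 𝒮 R* ⊥⊥)))
mainTheorem12 R' =
  MultiEvalClosure R' ,
  (closure-isMultiEval R' , closure-contains R' , closure-least R') ,
  λ ⊥⊥ → 𝒮-antitone (closure-contains R') ⊥⊥ , 𝒮-closure R' ⊥⊥
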